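{- Let $\mathsf{K}$ be a small $\mathsf{DCpo}^\vee$-enriched category. For all objects $X,Y$ of $\mathsf{K}$, the map $\Theta_{X,Y}:\widehat{\mathsf{K}}(\widehat{X},\widehat{Y})\to\mathsf{K}(X,Y)$, $\Theta(f)=f_Y(id_Y)$, is left adjoint (as a monotone map between posets) to the hom-restriction $\widehat{(-)}:\mathsf{K}(X,Y)\to\widehat{\mathsf{K}}(\widehat{X},\widehat{Y})$. Hence the functor $\widehat{(-)}:\mathsf{K}\to\widehat{\mathsf{K}}$ is a locally reflective embedding.
   Context: $\mathsf{DCpo}^\vee$: posets with directed suprema and binary joins, Scott-continuous maps, pointwise order; $\mathsf{DCpo}^\vee$-enriched means hom-sets are such posets and composition is monotone and preserves directed suprema in each variable. $\widetilde{\mathsf{K}}$ is the category of lax functors $\mathsf{K}\to\mathsf{DCpo}^\vee$ and oplax transformations ($f_{X'}\circ\pi(g)\leq\pi'(g)\circ f_X$), ordered pointwise. For $X\in\mathsf{K}$, $\widehat{X}=\mathsf{K}(X,-):\mathsf{K}\to\mathsf{DCpo}^\vee$ (sending $g:Y\to Y'$ to $h\mapsto g\circ h$); for $f:X\to X'$ in $\mathsf{K}$, $\widehat{f}=\mathsf{K}(f,-):\widehat{X'}\to\widehat{X}$ with components $h\mapsto h\circ f$. $\widehat{\mathsf{K}}$ is the full subcategory of $\widetilde{\mathsf{K}}^{op}$ on the objects $\widehat{X}$, so $\widehat{\mathsf{K}}(\widehat{X},\widehat{Y})=\widetilde{\mathsf{K}}(\widehat{Y},\widehat{X})$ and $\widehat{f}$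 is a morphism $\widehat{X}\to\widehat{X'}$ of $\widehat{\mathsf{K}}$; this gives a locally monotonic functor $\widehat{(-)}:\mathsf{K}\to\widehat{\mathsf{K}}$. For $f\in\widetilde{\mathsf{K}}(\widehat{Y},\widehat{X})$, $f_Y:\mathsf{K}(Y,Y)\to\mathsf{K}(X,Y)$. A locally monotonic faithful functor $F$ is locally reflective (a locally reflective embedding) if each hom-restriction $F_{X,Y}$, viewed as a monotone map of posets, has a left adjoint. -}

module Defs where

open import Level using (Level; 0ℓ) renaming (suc to lsuc)
open import Data.Product using (Σ; ∃; _×_; _,_; proj₁; proj₂)
open import Function using (_⇔_)
open import Relation.Binary.PropositionalEquality using (_≡_; refl; sym; subst)
open import Relation.Binary.Structures using (IsPartialOrder)

module _ {A : Set} (_≤_ : A → A → Set) where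

  IsUpperBound : {I : Set} → (I → A) → A → Set
  IsUpperBound d s = ∀ i → d i ≤ s

  IsLub : {I : Set} → (I → A) → A → Set
  IsLub d s = IsUpperBound d s × (∀ t → IsUpperBound d t → s ≤ t)

  IsDirected : {I : Set} → (I → A) → Set
  IsDirected {I} d = I × (∀ i j → Σ I λ k → (d i ≤ d k) × (d j ≤ d k))

record DCpoJ : Set₁ where
  infix 4 _≤_
  infixr 6 _∨_
  field
    Carrier        : Set
    _≤_            : Carrier → Carrier → Set
    isPartialOrder : IsPartialOrder _≡_ _≤_
    _∨_            : Carrier → Carrier → Carrier
    ∨-lub          : ∀ a b c → (a ≤ a ∨ b) × (b ≤ a ∨ b)
                     × (a ≤ c → b ≤ c → a ∨ b ≤ c)
    ⋁              : {I : Set} (d : I → Carrier) → IsDirected _≤_ d → Carrier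
    ⋁-lub          : {I : Set} (d : I → Carrier) (dir : IsDirected _≤_ d) →
                     IsLub _≤_ d (⋁ d dir)

open DCpoJ public using (Carrier)

IsScott : (A B : DCpoJ) → (Carrier A → Carrier B) → Set₁
IsScott A B f =
  (∀ {a a'} → DCpoJ._≤_ A a a' → DCpoJ._≤_ B (f a) (f a'))
  × (∀ {I : Set} (d : I → Carrier A) (dir : IsDirected (DCpoJ._≤_ A) d) →
       IsLub (DCpoJ._≤_ B) (λ i → f (d i)) (f (DCpoJ.⋁ A d dir)))

record ScottMap (A B : DCpoJ) : Set₁ where
  constructor scott
  field
    fun     : Carrier A → Carrier B
    isScott : IsScott A B fun

open ScottMap public

record EnrCat : Set₁ where
  infixr 9 _∘_
  field
    Obj  : Set
    Hom  : Obj → Obj → DCpoJ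
  H : Obj → Obj → Set
  H X Y = Carrier (Hom X Y)
  _≤[_,_]_ : {X Y : Obj} → H X Y → (X' Y' : Obj) → H X Y → Set
  _≤[_,_]_ {X} {Y} f _ _ g = DCpoJ._≤_ (Hom X Y) f g
  field
    id   : ∀ {X} → H X X
    _∘_  : ∀ {X Y Z} → H Y Z → H X Y → H X Z
    idˡ  : ∀ {X Y} (f : H X Y) → id ∘ f ≡ f
    idʳ  : ∀ {X Y} (f : H X Y) → f ∘ id ≡ f
    assoc : ∀ {W X Y Z} (h : H Y Z) (g : H X Y) (f : H W X) →
            (h ∘ g) ∘ f ≡ h ∘ (g ∘ f)
    ∘-scottˡ : ∀ {X Y Z} (f : H X Y) → IsScott (Hom Y Z) (Hom X Z) (λ g → g ∘ f)
    ∘-scottʳ : ∀ {X Y Z} (g : H Y Z) → IsScott (Hom X Y) (Hom X Z) (λ f → g ∘ f)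

-- K̃ : lax functors K → DCpo^∨ and oplax transformations

module _ (K : EnrCat) where
  open EnrCat K

  record LaxFunctor : Set₁ where
    field
      F₀ : Obj → DCpoJ
      F₁ : ∀ {X Y} → H X Y → ScottMap (F₀ X) (F₀ Y)
      F₁-mono : ∀ {X Y} {g g' : H X Y} → DCpoJ._≤_ (Hom X Y) g g' →
                ∀ a → DCpoJ._≤_ (F₀ Y) (fun (F₁ g) a) (fun (F₁ g') a)
      lax-id  : ∀ {X} a → DCpoJ._≤_ (F₀ X) a (fun (F₁ (id {X})) a)
      lax-∘   : ∀ {X Y Z} (g : H Y Z) (f : H X Y) a →
                DCpoJ._≤_ (F₀ Z) (fun (F₁ g) (fun (F₁ f) a)) (fun (F₁ (g ∘ f)) a)

  open LaxFunctor public

  record Oplax (π π' : LaxFunctor) : Set₁ where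
    field
      comp : ∀ X → ScottMap (F₀ π X) (F₀ π' X)
      oplax : ∀ {X X'} (g : H X X') a →
              DCpoJ._≤_ (F₀ π' X') (fun (comp X') (fun (F₁ π g) a))
                                   (fun (F₁ π' g) (fun (comp X) a))

  open Oplax public

  _≤ₜ_ : ∀ {π π'} → Oplax π π' → Oplax π π' → Set
  _≤ₜ_ {π} {π'} f f' = ∀ X a → DCpoJ._≤_ (F₀ π' X) (fun (comp f X) a) (fun (comp f' X) a)

  ≤-reflK : ∀ {X Y} {f g : H X Y} → f ≡ g → DCpoJ._≤_ (Hom X Y) f g
  ≤-reflK {X} {Y} refl = IsPartialOrder.refl (DCpoJ.isPartialOrder (Hom X Y))

  hat₀ : Obj → LaxFunctor
  hat₀ X = record
    { F₀ = λ Y → Hom X Y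
    ; F₁ = λ g → scott (λ h → g ∘ h) (∘-scottʳ g)
    ; F₁-mono = λ {_} {_} {g} {g'} g≤g' h → proj₁ (∘-scottˡ h) g≤g'
    ; lax-id = λ a → ≤-reflK (sym (idˡ a))
    ; lax-∘ = λ g f a → ≤-reflK (sym (assoc g f a))
    }

  -- K̂(X̂, Ŷ) = K̃(Ŷ, X̂)
  HatHom : Obj → Obj → Set₁
  HatHom X Y = Oplax (hat₀ Y) (hat₀ X)

  -- f̂ = K(f,-) : X̂' → X̂ in K̃, i.e. X̂ → X̂' in K̂ ; components h ↦ h ∘ f
  hat₁ : ∀ {X X'} → H X X' → HatHom X X'
  hat₁ f = record
    { comp = λ Z → scott (λ h → h ∘ f) (∘-scottˡ f)
    ; oplax = λ g h → ≤-reflK (assoc g h f)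
    }

  Θ : ∀ {X Y} → HatHom X Y → H X Y
  Θ {X} {Y} f = fun (comp f Y) (id {Y})

  IsLeftAdjoint : {a b : Level} {A : Set a} {B : Set b}
                  (_≤A_ : A → A → Set) (_≤B_ : B → B → Set) →
                  (A → B) → (B → A) → Set (a Level.⊔ b)
  IsLeftAdjoint _≤A_ _≤B_ L R =
    (∀ {a a'} → a ≤A a' → L a ≤B L a')
    × (∀ {b b'} → b ≤B b' → R b ≤A R b')
    × (∀ a b → (L a ≤B b) ⇔ (a ≤A R b))

  -- The functor (̂-) : K → K̂ is a locally reflective embedding:
  -- locally monotone, faithful (equality in the hom-poset K̂(X̂,Ŷ) being
  -- mutual ≤), and each hom-restriction has a left adjoint.
  HatIsLocallyReflectiveEmbedding : Set₁
  HatIsLocallyReflectiveEmbedding =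
    (∀ {X Y} {f g : H X Y} → DCpoJ._≤_ (Hom X Y) f g → hat₁ f ≤ₜ hat₁ g)
    × (∀ {X Y} (f g : H X Y) → hat₁ f ≤ₜ hat₁ g → hat₁ g ≤ₜ hat₁ f → f ≡ g)
    × (∀ X Y → Σ (HatHom X Y → H X Y) λ L →
         IsLeftAdjoint _≤ₜ_ (DCpoJ._≤_ (Hom X Y)) L hat₁)

-- The adjunction is obtained from the standard criterion for monotone maps
-- L : A → B, R : B → A between preorders: a unit a ≤ R (L a) and a counit
-- L (R b) ≤ b give  L a ≤ b ⇔ a ≤ R b.  Here L = Θ and R = (̂-):
--   * counit:  Θ (ĝ) = id ∘ g = g, so Θ is a retraction of (̂-);
--   * unit:    for f : Ŷ → X̂ in K̃ and h : Y → Z, the oplax square for h at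
--              id_Y reads  f_Z(h) = f_Z(h ∘ id) ≤ h ∘ f_Y(id) = h ∘ Θ(f),
--              i.e. f ≤ (Θ f)̂  pointwise.  Faithfulness follows from the
-- retraction: ĝ ≤ ĝ' gives g = Θ ĝ ≤ Θ ĝ' = g', and antisymmetry concludes.
module Submission where

open import Defs
open import Level using (Level)
open import Data.Product using (_×_; _,_; proj₁)
open import Function using (mk⇔)
open import Relation.Binary.PropositionalEquality using (_≡_; subst; subst₂)
open import Relation.Binary.Structures using (IsPartialOrder)

module HatAdjunction (K : EnrCat) where
  open EnrCat K

  infix 4 _⊑_
  _⊑_ : ∀ {X Y} → H X Y → H X Y → Set
  _⊑_ {X} {Y} = DCpoJ._≤_ (Hom X Y)

  ⊑-trans : ∀ {X Y} {a b c : H X Y} → a ⊑ b → b ⊑ c → a ⊑ c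
  ⊑-trans {X} {Y} = IsPartialOrder.trans (DCpoJ.isPartialOrder (Hom X Y))

  ⊑-antisym : ∀ {X Y} {a b : H X Y} → a ⊑ b → b ⊑ a → a ≡ b
  ⊑-antisym {X} {Y} = IsPartialOrder.antisym (DCpoJ.isPartialOrder (Hom X Y))

  ≤ₜ-trans : ∀ {π π' : LaxFunctor K} {f g k : Oplax K π π'} →
             _≤ₜ_ K f g → _≤ₜ_ K g k → _≤ₜ_ K f k
  ≤ₜ-trans {π' = π'} p q Z a =
    IsPartialOrder.trans (DCpoJ.isPartialOrder (F₀ π' Z)) (p Z a) (q Z a)

  adjunction-from-unit-counit :
    {a b : Level} {A : Set a} {B : Set b} (_≤A_ : A → A → Set) (_≤B_ : B → B → Set)
    (L : A → B) (R : B → A) →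
    (∀ {x x' x''} → x ≤A x' → x' ≤A x'' → x ≤A x'') →
    (∀ {y y' y''} → y ≤B y' → y' ≤B y'' → y ≤B y'') →
    (∀ {x x'} → x ≤A x' → L x ≤B L x') →
    (∀ {y y'} → y ≤B y' → R y ≤A R y') →
    (∀ x → x ≤A R (L x)) →
    (∀ y → L (R y) ≤B y) →
    IsLeftAdjoint K _≤A_ _≤B_ L R
  adjunction-from-unit-counit _ _ L R transA transB L-mono R-mono unit counit =
    L-mono , R-mono , λ x y → mk⇔
      (λ Lx≤y → transA (unit x) (R-mono Lx≤y))
      (λ x≤Ry → transB (L-mono x≤Ry) (counit y))

  hat-mono : ∀ {X Y} {g g' : H X Y} → g ⊑ g' → _≤ₜ_ K (hat₁ K g) (hat₁ K g')
  hat-mono g⊑g' Z h = proj₁ (∘-scottʳ h) g⊑g'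

  Θ-mono : ∀ {X Y} {f f' : HatHom K X Y} → _≤ₜ_ K f f' → Θ K f ⊑ Θ K f'
  Θ-mono {Y = Y} f≤f' = f≤f' Y id

  Θ-hat : ∀ {X Y} (g : H X Y) → Θ K (hat₁ K g) ≡ g
  Θ-hat g = idˡ g

  oplax-at-id : ∀ {X Y Z} (f : HatHom K X Y) (h : H Y Z) →
                fun (comp f Z) h ⊑ h ∘ Θ K f
  oplax-at-id {Y = Y} {Z} f h =
    subst (λ k → fun (comp f Z) k ⊑ h ∘ Θ K f) (idʳ h) (oplax f h (id {Y}))

  unit : ∀ {X Y} (f : HatHom K X Y) → _≤ₜ_ K f (hat₁ K (Θ K f))
  unit f Z h = oplax-at-id f h

  counit : ∀ {X Y} (g : H X Y) → Θ K (hat₁ K g) ⊑ g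
  counit {X} {Y} g =
    subst (Θ K (hat₁ K g) ⊑_) (Θ-hat g)
      (IsPartialOrder.refl (DCpoJ.isPartialOrder (Hom X Y)))

  -- Θ ⊣ (̂-) on each hom-poset.  The pointwise order _≤ₜ_ is a defined
  -- function, so the transformations it compares are passed explicitly.
  Θ⊣hat : (X Y : Obj) →
    IsLeftAdjoint K (_≤ₜ_ K) (_⊑_ {X} {Y}) (Θ K {X} {Y}) (hat₁ K {X} {Y})
  Θ⊣hat X Y = adjunction-from-unit-counit (_≤ₜ_ K) (_⊑_ {X} {Y}) (Θ K) (hat₁ K)
    (λ {f g k} → ≤ₜ-trans {f = f} {g} {k}) ⊑-trans
    (λ {f f'} → Θ-mono {f = f} {f'}) hat-mono unit counit

  -- (̂-) reflects the order, since Θ is a monotone retraction of it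
  hat-reflects : ∀ {X Y} {g g' : H X Y} →
                 _≤ₜ_ K (hat₁ K g) (hat₁ K g') → g ⊑ g'
  hat-reflects {g = g} {g'} ĝ≤ĝ' =
    subst₂ _⊑_ (Θ-hat g) (Θ-hat g') (Θ-mono {f = hat₁ K g} {hat₁ K g'} ĝ≤ĝ')

  hat-faithful : ∀ {X Y} (g g' : H X Y) →
                 _≤ₜ_ K (hat₁ K g) (hat₁ K g') → _≤ₜ_ K (hat₁ K g') (hat₁ K g) → g ≡ g'
  hat-faithful _ _ ĝ≤ĝ' ĝ'≤ĝ = ⊑-antisym (hat-reflects ĝ≤ĝ') (hat-reflects ĝ'≤ĝ)

theorem4p2 : (K : EnrCat) →
    ((X Y : EnrCat.Obj K) →
    IsLeftAdjoint K (_≤ₜ_ K) (DCpoJ._≤_ (EnrCat.Hom K X Y))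
    (Θ K {X} {Y}) (hat₁ K {X} {Y}))
    × HatIsLocallyReflectiveEmbedding K
theorem4p2 K = Θ⊣hat , (hat-mono , hat-faithful , λ X Y → Θ K , Θ⊣hat X Y)
  where open HatAdjunction K
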